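{- Let $p\geq 2$ and let $G=(V,E)$ be a $2p$-regular graph admitting a $(p+2)$-star colouring $f$. Then every bicoloured component of $G$ under $f$ is isomorphic to $K_{1,p}$, and all colour classes $V_i=f^{ -1}(i)$ have the same cardinality. Moreover, $f$ is both an equitable colouring and a fall colouring of $G$.
   Context: All graphs are finite and simple. A $k$-colouring of $G$ is a map $f:V(G)\to\{0,\dots,k-1\}$ with $f(u)\neq f(v)$ for every edge $uv$; it is a $k$-star colouring if no path on 4 vertices in $G$ receives only two colours. A bicoloured component of $G$ under $f$ is a connected component of $G[f^{ -1}(i)\cup f^{ -1}(j)]$ for some pair of distinct colours $i,j$. A colouring is equitable if the sizes of any two colour classes differ by at most one. A $k$-colouring is a fall colouring if every vertex has all $k$ colours present in its closed neighbourhood. -}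

module Defs where

open import Data.Nat using (ℕ; zero; suc; _+_; _*_; _≤_)
open import Data.Fin using (Fin; zero; suc; _≟_)
open import Data.Bool using (Bool; true; false; if_then_else_)
open import Data.List using (List; map; allFin)
open import Data.Nat.ListAction using (sum)
open import Data.Product using (Σ; ∃; ∃-syntax; _×_; _,_)
open import Data.Sum using (_⊎_)
open import Relation.Nullary using (¬_; does)
open import Relation.Binary.PropositionalEquality using (_≡_; _≢_)
open import Function.Bundles using (_⇔_)
open import Function.Definitions using (Injective)

record Graph : Set where
  field
    n     : ℕ
    adj   : Fin n → Fin n → Bool
    sym   : ∀ u v → adj u v ≡ adj v u
    loopless : ∀ v → adj v v ≡ false
open Graph public

count : {m : ℕ} → (Fin m → Bool) → ℕ
count {m} P = sum (map (λ x → if P x then 1 else 0) (allFin m))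

degree : (G : Graph) → Fin (n G) → ℕ
degree G v = count (adj G v)

Regular : ℕ → Graph → Set
Regular d G = ∀ v → degree G v ≡ d

Colouring : Graph → ℕ → Set
Colouring G k = Fin (n G) → Fin k

IsProper : (G : Graph) {k : ℕ} → Colouring G k → Set
IsProper G f = ∀ u v → adj G u v ≡ true → f u ≢ f v

IsP4 : (G : Graph) → (a b c d : Fin (n G)) → Set
IsP4 G a b c d =
  (a ≢ b) × (a ≢ c) × (a ≢ d) × (b ≢ c) × (b ≢ d) × (c ≢ d) ×
  (adj G a b ≡ true) × (adj G b c ≡ true) × (adj G c d ≡ true)

OnlyTwoColours : {m k : ℕ} → (Fin m → Fin k) → (a b c d : Fin m) → Set
OnlyTwoColours {k = k} f a b c d =
  ∃[ i ] ∃[ j ] (∀ x → (x ≡ a) ⊎ (x ≡ b) ⊎ (x ≡ c) ⊎ (x ≡ d) → (f x ≡ i) ⊎ (f x ≡ j))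

IsStarColouring : (G : Graph) {k : ℕ} → Colouring G k → Set
IsStarColouring G f =
  IsProper G f × (∀ a b c d → IsP4 G a b c d → ¬ OnlyTwoColours f a b c d)

InBi : {m k : ℕ} → (Fin m → Fin k) → Fin k → Fin k → Fin m → Set
InBi f i j v = (f v ≡ i) ⊎ (f v ≡ j)

data BiReach (G : Graph) {k : ℕ} (f : Colouring G k) (i j : Fin k)
     : Fin (n G) → Fin (n G) → Set where
  here : ∀ {v} → InBi f i j v → BiReach G f i j v v
  step : ∀ {u v w} → BiReach G f i j u v → adj G v w ≡ true → InBi f i j w →
         BiReach G f i j u w

starAdj : {p : ℕ} → Fin (suc p) → Fin (suc p) → Bool
starAdj zero zero = false
starAdj zero (suc _) = true
starAdj (suc _) zero = true
starAdj (suc _) (suc _) = false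

-- the bicoloured component (colours i,j) containing v, i.e. the induced
-- subgraph of G on {w | BiReach G f i j v w}, is isomorphic to K_{1,p}
ComponentIsoStar : (G : Graph) {k : ℕ} (f : Colouring G k) (i j : Fin k)
                   (v : Fin (n G)) (p : ℕ) → Set
ComponentIsoStar G f i j v p =
  Σ (Fin (suc p) → Fin (n G)) λ φ →
    Injective _≡_ _≡_ φ ×
    (∀ w → BiReach G f i j v w ⇔ (∃[ a ] φ a ≡ w)) ×
    (∀ a b → adj G (φ a) (φ b) ≡ starAdj a b)

classSize : (G : Graph) {k : ℕ} → Colouring G k → Fin k → ℕ
classSize G f i = count (λ v → does (f v ≟ i))

IsEquitable : (G : Graph) {k : ℕ} → Colouring G k → Set
IsEquitable G f = ∀ i j → classSize G f i ≤ classSize G f j + 1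

IsFall : (G : Graph) {k : ℕ} → Colouring G k → Set
IsFall G f = IsProper G f ×
  (∀ v i → (f v ≡ i) ⊎ (∃[ w ] (adj G v w ≡ true × f w ≡ i)))

-- Write d v j for the number of neighbours of v of colour j, and call w a sole
-- neighbour of v when it is v's only neighbour of colour f w.  An edge that is sole
-- from neither end extends on both sides to a two-coloured P4, so every edge is
-- sole from at least one end.  The p + 1 values d v j, j ≢ f v, sum to 2p, so at
-- most p of them are 1: v has at most p sole neighbours.  Double counting edges
-- makes both bounds tight, so each edge is sole from exactly one end and d v j is 1
-- for p colours and p for the last one.  Hence the bicoloured components are stars
-- K_{1,p} centred at the vertices with p neighbours of the other colour, and every
-- vertex sees every colour.  Outside a colour class V_i every vertex is a leaf (one
-- neighbour in V_i) or a centre (p of them); counting edges gives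
-- #centres = |V_i| and #leaves = p |V_i|, so n = (p + 2) |V_i| for every i.
module Submission where

open import Defs renaming (sym to adj-sym)
open import Data.Bool using (Bool; true; false; _∧_; if_then_else_)
open import Data.Fin as Fin using (Fin; zero; suc; punchIn; punchOut)
open import Data.Fin.Properties using (punchInᵢ≢i; punchIn-punchOut; suc-injective)
open import Data.List using (tabulate)
open import Data.List.Properties using (map-tabulate)
import Data.Nat.ListAction as List
open import Data.Nat using (ℕ; zero; suc; _+_; _*_; _≤_; z≤n; s≤s; s≤s⁻¹; _≟_; ≢-nonZero)
open import Data.Nat.Properties hiding (suc-injective)
open import Algebra.Properties.Semiring.Sum +-*-semiring
open import Algebra.Properties.CommutativeSemigroup *-commutativeSemigroup using (x∙yz≈y∙xz)
open import Data.Product using (∃-syntax; _×_; _,_; proj₁; proj₂)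
open import Data.Sum using (_⊎_; inj₁; inj₂)
open import Data.Vec.Functional using (removeAt)
open import Function using (_∘_; id)
open import Function.Bundles using (mk⇔; Equivalence)
open import Function.Definitions using (Injective)
open import Relation.Nullary using (¬_; Dec; yes; no; does; contradiction)
open import Relation.Nullary.Decidable using (dec-true; dec-false)
open import Relation.Binary.PropositionalEquality

𝟙 : Bool → ℕ
𝟙 b = if b then 1 else 0

𝟙≤1 : ∀ b → 𝟙 b ≤ 1
𝟙≤1 true  = ≤-refl
𝟙≤1 false = z≤n

𝟙-∧ : ∀ a b → 𝟙 (a ∧ b) ≡ 𝟙 a * 𝟙 b
𝟙-∧ true  true  = refl
𝟙-∧ true  false = refl
𝟙-∧ false b     = refl

𝟙-yes : ∀ {A : Set} (a? : Dec A) → A → 𝟙 (does a?) ≡ 1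
𝟙-yes a? a = cong 𝟙 (dec-true a? a)

𝟙-no : ∀ {A : Set} (a? : Dec A) → ¬ A → 𝟙 (does a?) ≡ 0
𝟙-no a? ¬a = cong 𝟙 (dec-false a? ¬a)

sum-const : ∀ m c → ∑[ x < m ] c ≡ m * c
sum-const zero    c = refl
sum-const (suc m) c = cong (c +_) (sum-const m c)

sum-mono-≤ : ∀ {m} {f g : Fin m → ℕ} → (∀ x → f x ≤ g x) → sum f ≤ sum g
sum-mono-≤ {zero}  f≤g = z≤n
sum-mono-≤ {suc m} f≤g = +-mono-≤ (f≤g zero) (sum-mono-≤ (f≤g ∘ suc))

≤-sum : ∀ {m} (f : Fin m → ℕ) x → f x ≤ sum f
≤-sum {suc _} f x = subst (f x ≤_) (sym (sum-remove f)) (m≤m+n (f x) _)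

sum-mono-≤-rigid : ∀ {m} {f g : Fin m → ℕ} → (∀ x → f x ≤ g x) → sum g ≤ sum f → ∀ x → f x ≡ g x
sum-mono-≤-rigid {suc m} {f} {g} f≤g ∑g≤∑f x = ≤-antisym (f≤g x) (+-cancelʳ-≤ _ (g x) (f x) (begin
  g x + sum (removeAt g x) ≡⟨ sum-remove g ⟨
  sum g                    ≤⟨ ∑g≤∑f ⟩
  sum f                    ≡⟨ sum-remove f ⟩
  f x + sum (removeAt f x) ≤⟨ +-monoʳ-≤ (f x) (sum-mono-≤ (f≤g ∘ punchIn x)) ⟩
  f x + sum (removeAt g x) ∎))
  where open ≤-Reasoning

∣_∣ : ∀ {m} → (Fin m → Bool) → ℕ
∣_∣ {m} P = ∑[ x < m ] 𝟙 (P x)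

count≡∣∣ : ∀ {m} (P : Fin m → Bool) → count P ≡ ∣ P ∣
count≡∣∣ {m} P = trans (cong List.sum (map-tabulate id (𝟙 ∘ P))) (sum-tabulate (𝟙 ∘ P))
  where
  sum-tabulate : ∀ {k} (g : Fin k → ℕ) → List.sum (tabulate g) ≡ sum g
  sum-tabulate {zero}  g = refl
  sum-tabulate {suc k} g = cong (g zero +_) (sum-tabulate (g ∘ suc))

sum-𝟙*≡*∣∣ : ∀ {m} (P : Fin m → Bool) (g : Fin m → ℕ) c → (∀ x → P x ≡ true → g x ≡ c) →
              ∑[ x < m ] (𝟙 (P x) * g x) ≡ c * ∣ P ∣
sum-𝟙*≡*∣∣ P g c g≡c = trans (sum-cong-≗ term) (sym (*-distribˡ-sum c (𝟙 ∘ P)))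
  where
  term : ∀ x → 𝟙 (P x) * g x ≡ c * 𝟙 (P x)
  term x with P x in Px
  ... | true  = trans (*-identityˡ (g x)) (trans (g≡c x Px) (sym (*-identityʳ c)))
  ... | false = sym (*-zeroʳ c)

∣P∣≤m : ∀ {m} (P : Fin m → Bool) → ∣ P ∣ ≤ m
∣P∣≤m {m} P = subst (∣ P ∣ ≤_) (trans (sum-const m 1) (*-identityʳ m)) (sum-mono-≤ (𝟙≤1 ∘ P))

∣P∣≡m⇒P : ∀ {m} (P : Fin m → Bool) → ∣ P ∣ ≡ m → ∀ x → P x ≡ true
∣P∣≡m⇒P {m} P ∣P∣≡m x = 𝟙≡1 (sum-mono-≤-rigid (𝟙≤1 ∘ P) m≤∣P∣ x)
  where
  m≤∣P∣ : ∑[ _ < m ] 1 ≤ ∣ P ∣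
  m≤∣P∣ = ≤-reflexive (trans (sum-const m 1) (trans (*-identityʳ m) (sym ∣P∣≡m)))
  𝟙≡1 : ∀ {b} → 𝟙 b ≡ 1 → b ≡ true
  𝟙≡1 {true} _ = refl

∣P∣>0⇒∃P : ∀ {m} (P : Fin m → Bool) → 1 ≤ ∣ P ∣ → ∃[ x ] P x ≡ true
∣P∣>0⇒∃P {suc m} P ∣P∣>0 with P zero in P0
... | true  = zero , P0
... | false = let x , Px = ∣P∣>0⇒∃P (P ∘ suc) ∣P∣>0 in suc x , Px

∣P∣≥2 : ∀ {m} (P : Fin m → Bool) {x y} → x ≢ y → P x ≡ true → P y ≡ true → 2 ≤ ∣ P ∣
∣P∣≥2 {suc m} P {x} {y} x≢y Px Py = begin
  2                                   ≡⟨ cong₂ (λ a b → 𝟙 a + 𝟙 b) Px (trans (cong P y≡x↑) Py) ⟨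
  𝟙 (P x) + 𝟙 (P (punchIn x y↓))       ≤⟨ +-monoʳ-≤ (𝟙 (P x)) (≤-sum (𝟙 ∘ P ∘ punchIn x) y↓) ⟩
  𝟙 (P x) + sum (removeAt (𝟙 ∘ P) x)  ≡⟨ sum-remove (𝟙 ∘ P) ⟨
  ∣ P ∣                               ∎
  where
  open ≤-Reasoning
  y↓ = punchOut x≢y
  y≡x↑ : punchIn x y↓ ≡ y
  y≡x↑ = punchIn-punchOut x≢y

∣P∣≡1⇒P-unique : ∀ {m} (P : Fin m → Bool) → ∣ P ∣ ≡ 1 → ∀ {x y} → P x ≡ true → P y ≡ true → x ≡ y
∣P∣≡1⇒P-unique P ∣P∣≡1 {x} {y} Px Py with x Fin.≟ y
... | yes x≡y = x≡y
... | no  x≢y = contradiction (subst (2 ≤_) ∣P∣≡1 (∣P∣≥2 P x≢y Px Py)) (<-irrefl refl)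

∣P∣≢1⇒another : ∀ {m} (P : Fin m → Bool) {x} → P x ≡ true → ∣ P ∣ ≢ 1 → ∃[ y ] y ≢ x × P y ≡ true
∣P∣≢1⇒another {suc m} P {x} Px ∣P∣≢1 =
  let t , Pt = ∣P∣>0⇒∃P (P ∘ punchIn x) rest>0 in punchIn x t , punchInᵢ≢i x t , Pt
  where
  rest>0 : 1 ≤ ∣ P ∘ punchIn x ∣
  rest>0 with ∣ P ∘ punchIn x ∣ in eq
  ... | suc _ = s≤s z≤n
  ... | zero  = contradiction (trans (sum-remove (𝟙 ∘ P)) (cong₂ _+_ (cong 𝟙 Px) eq)) ∣P∣≢1

record Enumeration {m} (P : Fin m → Bool) (k : ℕ) : Set where
  field
    enum          : Fin k → Fin m
    enum-injective : Injective _≡_ _≡_ enum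
    enum-sound    : ∀ t → P (enum t) ≡ true
    enum-complete : ∀ x → P x ≡ true → ∃[ t ] enum t ≡ x

enumerate : ∀ {m} (P : Fin m → Bool) → Enumeration P ∣ P ∣
enumerate {zero} P = record
  { enum = λ () ; enum-injective = λ { {()} } ; enum-sound = λ () ; enum-complete = λ () }
enumerate {suc m} P with P zero in P0
... | true  = record
  { enum           = λ { zero → zero ; (suc t) → suc (enum t) }
  ; enum-injective = λ { {zero}  {zero}  _ → refl
                       ; {suc s} {suc t} e → cong suc (enum-injective (suc-injective e)) }
  ; enum-sound     = λ { zero → P0 ; (suc t) → enum-sound t }
  ; enum-complete  = λ { zero _ → zero , refl
                       ; (suc x) Px → let t , e = enum-complete x Px in suc t , cong suc e }
  }
  where open Enumeration (enumerate (P ∘ suc))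
... | false = record
  { enum           = suc ∘ enum
  ; enum-injective = enum-injective ∘ suc-injective
  ; enum-sound     = enum-sound
  ; enum-complete  = λ { zero P0′ → contradiction (trans (sym P0) P0′) λ ()
                       ; (suc x) Px → let t , e = enum-complete x Px in t , cong suc e }
  }
  where open Enumeration (enumerate (P ∘ suc))

fromDoes : ∀ {A : Set} (a? : Dec A) → does a? ≡ true → A
fromDoes (yes a) _ = a

is1 : ℕ → Bool
is1 m = does (m ≟ 1)


all-is1⇒sum≡m : ∀ {m} (e : Fin m → ℕ) → ∣ is1 ∘ e ∣ ≡ m → sum e ≡ m
all-is1⇒sum≡m {m} e all = begin
  sum e          ≡⟨ sum-cong-≗ (λ x → fromDoes (e x ≟ 1) (∣P∣≡m⇒P (is1 ∘ e) all x)) ⟩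
  ∑[ _ < m ] 1  ≡⟨ sum-const m 1 ⟩
  m * 1          ≡⟨ *-identityʳ m ⟩
  m              ∎
  where open ≡-Reasoning

-- p + 1 numbers with sum 2p cannot all equal 1 unless p = 1.
∣is1∣≤p : ∀ {p} → p ≢ 1 → (e : Fin (suc p) → ℕ) → sum e ≡ 2 * p → ∣ is1 ∘ e ∣ ≤ p
∣is1∣≤p {p} p≢1 e ∑e≡2p = s≤s⁻¹ (≤∧≢⇒< (∣P∣≤m (is1 ∘ e)) not-all-1)
  where
  not-all-1 : ∣ is1 ∘ e ∣ ≢ suc p
  not-all-1 all = p≢1 (sym (+-cancelʳ-≡ p 1 p (begin
    suc p      ≡⟨ all-is1⇒sum≡m e all ⟨
    sum e      ≡⟨ ∑e≡2p ⟩
    p + (p + 0) ≡⟨ cong (p +_) (+-identityʳ p) ⟩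
    p + p       ∎)))
    where open ≡-Reasoning

∣is1∣≡p⇒≡p : ∀ {p} (e : Fin (suc p) → ℕ) → sum e ≡ 2 * p → ∣ is1 ∘ e ∣ ≡ p → ∀ k → e k ≢ 1 → e k ≡ p
∣is1∣≡p⇒≡p {p} e ∑e≡2p ∣is1∣≡p k ek≢1 = +-cancelʳ-≡ p (e k) p (begin
  e k + p                  ≡⟨ cong (e k +_) (all-is1⇒sum≡m (removeAt e k) rest≡p) ⟨
  e k + sum (removeAt e k) ≡⟨ sum-remove e ⟨
  sum e                    ≡⟨ ∑e≡2p ⟩
  p + (p + 0)              ≡⟨ cong (p +_) (+-identityʳ p) ⟩
  p + p                    ∎)
  where
  open ≡-Reasoning
  rest≡p : ∣ is1 ∘ removeAt e k ∣ ≡ p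
  rest≡p = trans (cong (_+ ∣ is1 ∘ removeAt e k ∣) (sym (𝟙-no (e k ≟ 1) ek≢1)))
                 (trans (sym (sum-remove (𝟙 ∘ is1 ∘ e))) ∣is1∣≡p)

sum-δ : ∀ {k} (h : Fin k → ℕ) c → ∑[ j < k ] (h j * 𝟙 (does (c Fin.≟ j))) ≡ h c
sum-δ {suc k} h c = begin
  ∑[ j < suc k ] (h j * δ j)
    ≡⟨ sum-remove (λ j → h j * δ j) ⟩
  h c * δ c + ∑[ j < k ] (h (punchIn c j) * δ (punchIn c j))
    ≡⟨ cong₂ _+_ (cong (h c *_) (𝟙-yes (c Fin.≟ c) refl))
                 (sum-cong-≗ λ j → cong (h (punchIn c j) *_) (𝟙-no (c Fin.≟ _) (punchInᵢ≢i c j ∘ sym))) ⟩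
  h c * 1 + ∑[ j < k ] (h (punchIn c j) * 0)
    ≡⟨ cong₂ _+_ (*-identityʳ (h c)) (trans (sum-cong-≗ λ j → *-zeroʳ (h (punchIn c j))) (sum-replicate-zero k)) ⟩
  h c + 0
    ≡⟨ +-identityʳ (h c) ⟩
  h c ∎
  where
  open ≡-Reasoning
  δ : Fin (suc k) → ℕ
  δ j = 𝟙 (does (c Fin.≟ j))

nbrSum : (G : Graph) → Fin (n G) → (Fin (n G) → ℕ) → ℕ
nbrSum G v h = ∑[ w < n G ] (𝟙 (adj G v w) * h w)

nbrSum-1≡degree : (G : Graph) (v : Fin (n G)) → nbrSum G v (λ _ → 1) ≡ degree G v
nbrSum-1≡degree G v = trans (sum-cong-≗ λ w → *-identityʳ (𝟙 (adj G v w))) (sym (count≡∣∣ (adj G v)))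

*-nbrSum : (G : Graph) (c : ℕ) (v : Fin (n G)) (h : Fin (n G) → ℕ) →
           c * nbrSum G v h ≡ nbrSum G v (λ w → c * h w)
*-nbrSum G c v h = trans (*-distribˡ-sum c (λ w → 𝟙 (adj G v w) * h w))
                         (sum-cong-≗ λ w → x∙yz≈y∙xz c (𝟙 (adj G v w)) (h w))

nbrSum-flip : (G : Graph) (h : Fin (n G) → Fin (n G) → ℕ) →
              ∑[ v < n G ] nbrSum G v (h v) ≡ ∑[ v < n G ] nbrSum G v (λ w → h w v)
nbrSum-flip G h = trans (∑-comm (λ v w → 𝟙 (adj G v w) * h v w))
  (sum-cong-≗ λ w → sum-cong-≗ λ v → cong (λ b → 𝟙 b * h v w) (adj-sym G v w))

nbrSum-weighted-flip : (G : Graph) (u g : Fin (n G) → ℕ) →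
                       ∑[ v < n G ] (u v * nbrSum G v g) ≡ ∑[ v < n G ] (g v * nbrSum G v u)
nbrSum-weighted-flip G u g = begin
  ∑[ v < n G ] (u v * nbrSum G v g)
    ≡⟨ sum-cong-≗ (λ v → *-nbrSum G (u v) v g) ⟩
  ∑[ v < n G ] (nbrSum G v (λ w → u v * g w))
    ≡⟨ nbrSum-flip G (λ v w → u v * g w) ⟩
  ∑[ v < n G ] (nbrSum G v (λ w → u w * g v))
    ≡⟨ sum-cong-≗ (λ v → sum-cong-≗ λ w → cong (𝟙 (adj G v w) *_) (*-comm (u w) (g v))) ⟩
  ∑[ v < n G ] (nbrSum G v (λ w → g v * u w))
    ≡⟨ sum-cong-≗ (λ v → *-nbrSum G (g v) v u) ⟨
  ∑[ v < n G ] (g v * nbrSum G v u) ∎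
  where open ≡-Reasoning

module _ (G : Graph) {k : ℕ} (f : Colouring G k) where

  colourNbr : Fin (n G) → Fin k → Fin (n G) → Bool
  colourNbr v j w = adj G v w ∧ does (f w Fin.≟ j)

  colourDegree : Fin (n G) → Fin k → ℕ
  colourDegree v j = ∣ colourNbr v j ∣

  colourNbr-intro : ∀ {v j w} → adj G v w ≡ true → f w ≡ j → colourNbr v j w ≡ true
  colourNbr-intro {v} {j} {w} vw fw≡j = cong₂ _∧_ vw (dec-true (f w Fin.≟ j) fw≡j)

  colourNbr-elim : ∀ {v j w} → colourNbr v j w ≡ true → adj G v w ≡ true × f w ≡ j
  colourNbr-elim {v} {j} {w} _ with adj G v w | f w Fin.≟ j
  ... | true | yes fw≡j = refl , fw≡j

  colourDegree≡nbrSum : ∀ v j → colourDegree v j ≡ nbrSum G v (λ w → 𝟙 (does (f w Fin.≟ j)))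
  colourDegree≡nbrSum v j = sum-cong-≗ λ w → 𝟙-∧ (adj G v w) _

  nbrSum-by-colour : ∀ v (h : Fin k → ℕ) → nbrSum G v (h ∘ f) ≡ ∑[ j < k ] (h j * colourDegree v j)
  nbrSum-by-colour v h = begin
    nbrSum G v (h ∘ f)
      ≡⟨ sum-cong-≗ (λ w → cong (𝟙 (adj G v w) *_) (sum-δ h (f w))) ⟨
    nbrSum G v (λ w → ∑[ j < k ] (h j * δ j w))
      ≡⟨ sum-cong-≗ (λ w → *-distribˡ-sum (𝟙 (adj G v w)) (λ j → h j * δ j w)) ⟩
    ∑[ w < n G ] ∑[ j < k ] (𝟙 (adj G v w) * (h j * δ j w))
      ≡⟨ ∑-comm (λ w j → 𝟙 (adj G v w) * (h j * δ j w)) ⟩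
    ∑[ j < k ] ∑[ w < n G ] (𝟙 (adj G v w) * (h j * δ j w))
      ≡⟨ sum-cong-≗ (λ j → *-nbrSum G (h j) v (δ j)) ⟨
    ∑[ j < k ] (h j * nbrSum G v (δ j))
      ≡⟨ sum-cong-≗ (λ j → cong (h j *_) (colourDegree≡nbrSum v j)) ⟨
    ∑[ j < k ] (h j * colourDegree v j) ∎
    where
    open ≡-Reasoning
    δ = λ j w → 𝟙 (does (f w Fin.≟ j))

  colourDegree-sum : ∀ v → ∑[ j < k ] colourDegree v j ≡ degree G v
  colourDegree-sum v = begin
    ∑[ j < k ] colourDegree v j          ≡⟨ sum-cong-≗ (λ j → *-identityˡ (colourDegree v j)) ⟨
    ∑[ j < k ] (1 * colourDegree v j)    ≡⟨ nbrSum-by-colour v (λ _ → 1) ⟨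
    nbrSum G v (λ _ → 1)                 ≡⟨ nbrSum-1≡degree G v ⟩
    degree G v                           ∎
    where open ≡-Reasoning

  colourDegree-own : IsProper G f → ∀ v → colourDegree v (f v) ≡ 0
  colourDegree-own proper v with colourDegree v (f v) in eq
  ... | zero  = refl
  ... | suc _ with ∣P∣>0⇒∃P (colourNbr v (f v)) (subst (1 ≤_) (sym eq) (s≤s z≤n))
  ...   | w , vw∧fw≡fv = let vw , fw≡fv = colourNbr-elim vw∧fw≡fv
                         in contradiction (sym fw≡fv) (proper v w vw)

  colourDegree>0⇒nbr : ∀ {v j} → 1 ≤ colourDegree v j → ∃[ w ] adj G v w ≡ true × f w ≡ j
  colourDegree>0⇒nbr {v} {j} d>0 = let w , c = ∣P∣>0⇒∃P (colourNbr v j) d>0 in w , colourNbr-elim c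

  colourDegree≡1⇒nbr-unique : ∀ {v j x y} → colourDegree v j ≡ 1 →
    adj G v x ≡ true → f x ≡ j → adj G v y ≡ true → f y ≡ j → x ≡ y
  colourDegree≡1⇒nbr-unique {v} {j} d≡1 vx fx vy fy =
    ∣P∣≡1⇒P-unique (colourNbr v j) d≡1 (colourNbr-intro vx fx) (colourNbr-intro vy fy)

  colourDegree≢1⇒another-nbr : ∀ {v w} → adj G v w ≡ true → colourDegree v (f w) ≢ 1 →
    ∃[ w′ ] w′ ≢ w × adj G v w′ ≡ true × f w′ ≡ f w
  colourDegree≢1⇒another-nbr {v} {w} vw d≢1 =
    let w′ , w′≢w , c = ∣P∣≢1⇒another (colourNbr v (f w)) (colourNbr-intro vw refl) d≢1
    in w′ , w′≢w , colourNbr-elim c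

  sole : Fin (n G) → Fin (n G) → Bool
  sole v w = is1 (colourDegree v (f w))

  nbrSum-sole≡∣is1∘colourDegree∣ : ∀ v → nbrSum G v (𝟙 ∘ sole v) ≡ ∣ is1 ∘ colourDegree v ∣
  nbrSum-sole≡∣is1∘colourDegree∣ v = trans (nbrSum-by-colour v (𝟙 ∘ is1 ∘ colourDegree v))
                            (sum-cong-≗ λ j → 𝟙-is1-* (colourDegree v j))
    where
    𝟙-is1-* : ∀ m → 𝟙 (is1 m) * m ≡ 𝟙 (is1 m)
    𝟙-is1-* 0             = refl
    𝟙-is1-* 1             = refl
    𝟙-is1-* (suc (suc m)) = refl

  star⇒sole : IsStarColouring G f → ∀ {v w} → adj G v w ≡ true → sole v w ≡ true ⊎ sole w v ≡ true
  star⇒sole (proper , noP4) {v} {w} vw with colourDegree v (f w) ≟ 1 | colourDegree w (f v) ≟ 1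
  ... | yes d≡1 | _       = inj₁ (dec-true (_ ≟ 1) d≡1)
  ... | no  _   | yes d′≡1 = inj₂ (dec-true (_ ≟ 1) d′≡1)
  ... | no d≢1 | no d′≢1 =
    let w′ , w′≢w , vw′ , fw′≡fw = colourDegree≢1⇒another-nbr vw d≢1
        v′ , v′≢v , wv′ , fv′≡fv = colourDegree≢1⇒another-nbr wv d′≢1
        fv≢fw = proper v w vw
    in contradiction (f v , f w , twoColours fw′≡fw fv′≡fv)
         (noP4 w′ v w v′
           ( (λ w′≡v → fv≢fw (trans (cong f (sym w′≡v)) fw′≡fw))
           , w′≢w
           , (λ w′≡v′ → fv≢fw (trans (sym fv′≡fv) (trans (cong f (sym w′≡v′)) fw′≡fw)))
           , (λ v≡w → fv≢fw (cong f v≡w))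
           , (λ v≡v′ → v′≢v (sym v≡v′))
           , (λ w≡v′ → fv≢fw (trans (sym fv′≡fv) (cong f (sym w≡v′))))
           , trans (adj-sym G w′ v) vw′ , vw , wv′ ))
    where
    wv = trans (adj-sym G w v) vw
    twoColours : ∀ {w′ v′} → f w′ ≡ f w → f v′ ≡ f v →
                 ∀ x → (x ≡ w′) ⊎ (x ≡ v) ⊎ (x ≡ w) ⊎ (x ≡ v′) → (f x ≡ f v) ⊎ (f x ≡ f w)
    twoColours fw′≡fw _ _ (inj₁ refl)                 = inj₂ fw′≡fw
    twoColours _ _      _ (inj₂ (inj₁ refl))          = inj₁ refl
    twoColours _ _      _ (inj₂ (inj₂ (inj₁ refl)))   = inj₂ refl
    twoColours _ fv′≡fv _ (inj₂ (inj₂ (inj₂ refl)))   = inj₁ fv′≡fv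

  closedColourNbhd : Fin (n G) → Fin k → Fin (n G) → Set
  closedColourNbhd c β w = (w ≡ c) ⊎ (adj G c w ≡ true × f w ≡ β)

  centre⇒ComponentIsoStar : IsProper G f → ∀ {α β c p} → f c ≡ α → colourDegree c β ≡ p →
    (∀ {x} → adj G c x ≡ true → f x ≡ β → colourDegree x α ≡ 1) →
    ∀ {v} → closedColourNbhd c β v → ComponentIsoStar G f α β v p
  centre⇒ComponentIsoStar proper {α} {β} {c} {p} fc≡α d≡p leaf {v} v∈N =
    φ , φ-injective , (λ w → mk⇔ (reach⇒∈φ w) (∈φ⇒reach w)) , φ-adj
    where
    open Enumeration (subst (Enumeration (colourNbr c β)) d≡p (enumerate (colourNbr c β)))

    leafOf : ∀ t → adj G c (enum t) ≡ true × f (enum t) ≡ β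
    leafOf t = colourNbr-elim (enum-sound t)

    φ : Fin (suc p) → Fin (n G)
    φ zero    = c
    φ (suc t) = enum t

    nbr≢c : ∀ {x} → adj G c x ≡ true → x ≢ c
    nbr≢c cx refl = contradiction (trans (sym cx) (loopless G c)) λ ()

    φ-injective : Injective _≡_ _≡_ φ
    φ-injective {zero}  {zero}  _ = refl
    φ-injective {zero}  {suc t} e = contradiction (sym e) (nbr≢c (proj₁ (leafOf t)))
    φ-injective {suc s} {zero}  e = contradiction e (nbr≢c (proj₁ (leafOf s)))
    φ-injective {suc s} {suc t} e = cong suc (enum-injective e)

    N⇒∈φ : ∀ w → closedColourNbhd c β w → ∃[ t ] φ t ≡ w
    N⇒∈φ w (inj₁ refl)        = zero , refl
    N⇒∈φ w (inj₂ (cw , fw≡β)) = let t , e = enum-complete w (colourNbr-intro cw fw≡β) in suc t , e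

    ∈φ⇒N : ∀ w → ∃[ t ] φ t ≡ w → closedColourNbhd c β w
    ∈φ⇒N w (zero  , refl) = inj₁ refl
    ∈φ⇒N w (suc t , refl) = inj₂ (leafOf t)

    N-closed : ∀ {x y} → closedColourNbhd c β x → adj G x y ≡ true → InBi f α β y →
               closedColourNbhd c β y
    N-closed (inj₁ refl)        xy (inj₁ fy≡α) = contradiction (trans fc≡α (sym fy≡α)) (proper _ _ xy)
    N-closed (inj₁ refl)        xy (inj₂ fy≡β) = inj₂ (xy , fy≡β)
    N-closed (inj₂ (cx , fx≡β)) xy (inj₁ fy≡α) =
      inj₁ (colourDegree≡1⇒nbr-unique (leaf cx fx≡β) xy fy≡α (trans (adj-sym G _ c) cx) fc≡α)
    N-closed (inj₂ (cx , fx≡β)) xy (inj₂ fy≡β) = contradiction (trans fx≡β (sym fy≡β)) (proper _ _ xy)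

    reach⇒N : ∀ {w} → BiReach G f α β v w → closedColourNbhd c β w
    reach⇒N (here _)        = v∈N
    reach⇒N (step r xw w∈) = N-closed (reach⇒N r) xw w∈

    reach-c : ∀ {u} → closedColourNbhd c β u → BiReach G f α β u c
    reach-c (inj₁ refl)        = here (inj₁ fc≡α)
    reach-c (inj₂ (cu , fu≡β)) = step (here (inj₂ fu≡β)) (trans (adj-sym G _ c) cu) (inj₁ fc≡α)

    N⇒reach : ∀ w → closedColourNbhd c β w → BiReach G f α β v w
    N⇒reach w (inj₁ refl)        = reach-c v∈N
    N⇒reach w (inj₂ (cw , fw≡β)) = step (reach-c v∈N) cw (inj₂ fw≡β)

    reach⇒∈φ : ∀ w → BiReach G f α β v w → ∃[ t ] φ t ≡ w
    reach⇒∈φ w = N⇒∈φ w ∘ reach⇒N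

    ∈φ⇒reach : ∀ w → ∃[ t ] φ t ≡ w → BiReach G f α β v w
    ∈φ⇒reach w = N⇒reach w ∘ ∈φ⇒N w

    φ-adj : ∀ s t → adj G (φ s) (φ t) ≡ starAdj s t
    φ-adj zero    zero    = loopless G c
    φ-adj zero    (suc t) = proj₁ (leafOf t)
    φ-adj (suc s) zero    = trans (adj-sym G (enum s) c) (proj₁ (leafOf s))
    φ-adj (suc s) (suc t) with adj G (enum s) (enum t) in st
    ... | true  = contradiction (trans (proj₂ (leafOf s)) (sym (proj₂ (leafOf t)))) (proper _ _ st)
    ... | false = refl

  BiReach-swap : ∀ {i j u w} → BiReach G f i j u w → BiReach G f j i u w
  BiReach-swap (here (inj₁ fu≡i))    = here (inj₂ fu≡i)
  BiReach-swap (here (inj₂ fu≡j))    = here (inj₁ fu≡j)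
  BiReach-swap (step r vw (inj₁ fw≡i)) = step (BiReach-swap r) vw (inj₂ fw≡i)
  BiReach-swap (step r vw (inj₂ fw≡j)) = step (BiReach-swap r) vw (inj₁ fw≡j)

  ComponentIsoStar-swap : ∀ {i j v p} → ComponentIsoStar G f i j v p → ComponentIsoStar G f j i v p
  ComponentIsoStar-swap (φ , φ-injective , reach⇔∈φ , φ-adj) =
    φ , φ-injective
      , (λ w → mk⇔ (to (reach⇔∈φ w) ∘ BiReach-swap) (BiReach-swap ∘ from (reach⇔∈φ w)))
      , φ-adj
    where open Equivalence

-- Colours are Fin (2 + p) rather than Fin (p + 2) so that removing the colour of
-- a vertex leaves Fin (suc p) definitionally.
module RegularStarColouring {p : ℕ} (p≥2 : 2 ≤ p) {G : Graph} (regular : Regular (2 * p) G)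
                            {f : Colouring G (2 + p)} (star : IsStarColouring G f) where

  V : Set
  V = Fin (n G)

  proper : IsProper G f
  proper = proj₁ star

  d : V → Fin (2 + p) → ℕ
  d = colourDegree G f

  s : V → V → ℕ
  s v w = 𝟙 (sole G f v w)

  soleCount : V → ℕ
  soleCount v = nbrSum G v (s v)

  p≢0 : p ≢ 0
  p≢0 refl = contradiction p≥2 λ ()

  p≢1 : p ≢ 1
  p≢1 refl = contradiction p≥2 λ { (s≤s ()) }

  otherDegrees : V → Fin (suc p) → ℕ
  otherDegrees v = removeAt (d v) (f v)

  d-remove : ∀ {v} (h : ℕ → ℕ) → ∑[ j < 2 + p ] h (d v j) ≡ h 0 + ∑[ j < suc p ] h (otherDegrees v j)
  d-remove {v} h = trans (sum-remove (h ∘ d v))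
    (cong (λ m → h m + ∑[ j < suc p ] h (otherDegrees v j)) (colourDegree-own G f proper v))

  sum-otherDegrees : ∀ v → sum (otherDegrees v) ≡ 2 * p
  sum-otherDegrees v = trans (sym (d-remove id)) (trans (colourDegree-sum G f v) (regular v))

  soleCount≡∣is1∘otherDegrees∣ : ∀ v → soleCount v ≡ ∣ is1 ∘ otherDegrees v ∣
  soleCount≡∣is1∘otherDegrees∣ v = trans (nbrSum-sole≡∣is1∘colourDegree∣ G f v) (d-remove (𝟙 ∘ is1))

  soleCount≤p : ∀ v → soleCount v ≤ p
  soleCount≤p v = subst (_≤ p) (sym (soleCount≡∣is1∘otherDegrees∣ v))
                        (∣is1∣≤p p≢1 (otherDegrees v) (sum-otherDegrees v))

  edgeCover : V → ℕ
  edgeCover v = nbrSum G v (λ w → s v w + s w v)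

  edge-covered : ∀ v w → 𝟙 (adj G v w) * 1 ≤ 𝟙 (adj G v w) * (s v w + s w v)
  edge-covered v w = cover (adj G v w) refl
    where
    1≤𝟙+𝟙 : ∀ a b → a ≡ true ⊎ b ≡ true → 1 ≤ 𝟙 a + 𝟙 b
    1≤𝟙+𝟙 true  _     _        = s≤s z≤n
    1≤𝟙+𝟙 false true  _        = s≤s z≤n
    1≤𝟙+𝟙 false false (inj₁ ())
    1≤𝟙+𝟙 false false (inj₂ ())
    cover : ∀ b → adj G v w ≡ b → 𝟙 b * 1 ≤ 𝟙 b * (s v w + s w v)
    cover false _  = z≤n
    cover true  vw = subst (1 ≤_) (sym (*-identityˡ _)) (1≤𝟙+𝟙 _ _ (star⇒sole G f star vw))

  degree≤edgeCover : ∀ v → nbrSum G v (λ _ → 1) ≤ edgeCover v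
  degree≤edgeCover v = sum-mono-≤ (edge-covered v)

  ∑edgeCover : ∑[ v < n G ] edgeCover v ≡ ∑[ v < n G ] soleCount v + ∑[ v < n G ] soleCount v
  ∑edgeCover = begin
    ∑[ v < n G ] edgeCover v
      ≡⟨ sum-cong-≗ (λ v → trans (sum-cong-≗ λ w → *-distribˡ-+ (𝟙 (adj G v w)) (s v w) (s w v))
                                   (∑-distrib-+ (λ w → 𝟙 (adj G v w) * s v w) (λ w → 𝟙 (adj G v w) * s w v))) ⟩
    ∑[ v < n G ] (soleCount v + nbrSum G v (λ w → s w v))
      ≡⟨ ∑-distrib-+ soleCount (λ v → nbrSum G v (λ w → s w v)) ⟩
    ∑[ v < n G ] soleCount v + ∑[ v < n G ] nbrSum G v (λ w → s w v)
      ≡⟨ cong (∑[ v < n G ] soleCount v +_) (nbrSum-flip G (λ v w → s w v)) ⟩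
    ∑[ v < n G ] soleCount v + ∑[ v < n G ] soleCount v ∎
    where open ≡-Reasoning

  ∑degree : ∑[ v < n G ] nbrSum G v (λ _ → 1) ≡ ∑[ _ < n G ] p + ∑[ _ < n G ] p
  ∑degree = begin
    ∑[ v < n G ] nbrSum G v (λ _ → 1)
      ≡⟨ sum-cong-≗ (nbrSum-1≡degree G) ⟩
    ∑[ v < n G ] degree G v
      ≡⟨ sum-cong-≗ (λ v → trans (regular v) (cong (p +_) (+-identityʳ p))) ⟩
    ∑[ _ < n G ] (p + p)
      ≡⟨ ∑-distrib-+ {n G} (λ _ → p) (λ _ → p) ⟩
    ∑[ _ < n G ] p + ∑[ _ < n G ] p ∎
    where open ≡-Reasoning

  ∑edgeCover≤∑degree : ∑[ v < n G ] edgeCover v ≤ ∑[ v < n G ] nbrSum G v (λ _ → 1)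
  ∑edgeCover≤∑degree = subst₂ _≤_ (sym ∑edgeCover) (sym ∑degree) (+-mono-≤ ∑soleCount≤ ∑soleCount≤)
    where ∑soleCount≤ = sum-mono-≤ soleCount≤p

  soleCount≡p : ∀ v → soleCount v ≡ p
  soleCount≡p = sum-mono-≤-rigid soleCount≤p (+-cancelʳ-≤ P P (∑[ v < n G ] soleCount v) (begin
    P + P                                  ≡⟨ ∑degree ⟨
    ∑[ v < n G ] nbrSum G v (λ _ → 1)     ≤⟨ sum-mono-≤ degree≤edgeCover ⟩
    ∑[ v < n G ] edgeCover v              ≡⟨ ∑edgeCover ⟩
    ∑S + ∑S                               ≤⟨ +-monoʳ-≤ ∑S (sum-mono-≤ soleCount≤p) ⟩
    ∑S + P                                ∎))
    where
    open ≤-Reasoning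
    P  = ∑[ _ < n G ] p
    ∑S = ∑[ v < n G ] soleCount v

  sole-exclusive : ∀ {v w} → adj G v w ≡ true → s v w + s w v ≡ 1
  sole-exclusive {v} {w} vw = begin
    s v w + s w v                        ≡⟨ *-identityˡ _ ⟨
    1 * (s v w + s w v)                  ≡⟨ cong (λ b → 𝟙 b * (s v w + s w v)) vw ⟨
    𝟙 (adj G v w) * (s v w + s w v)      ≡⟨ edge-tight w ⟨
    𝟙 (adj G v w) * 1                    ≡⟨ cong (λ b → 𝟙 b * 1) vw ⟩
    1                                    ∎
    where
    open ≡-Reasoning
    edge-tight : ∀ w → 𝟙 (adj G v w) * 1 ≡ 𝟙 (adj G v w) * (s v w + s w v)
    edge-tight = sum-mono-≤-rigid (edge-covered v)
                   (≤-reflexive (sym (sum-mono-≤-rigid degree≤edgeCover ∑edgeCover≤∑degree v)))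

  sole⇒¬sole : ∀ {v w} → adj G v w ≡ true → sole G f v w ≡ true → sole G f w v ≡ false
  sole⇒¬sole {v} {w} vw sole-vw = 𝟙+𝟙≡1 _ _ (sole-exclusive vw) sole-vw
    where
    𝟙+𝟙≡1 : ∀ a b → 𝟙 a + 𝟙 b ≡ 1 → a ≡ true → b ≡ false
    𝟙+𝟙≡1 true false _ _ = refl

  d≢1⇒≡p : ∀ {v j} → j ≢ f v → d v j ≢ 1 → d v j ≡ p
  d≢1⇒≡p {v} {j} j≢fv d≢1 = subst (λ j → d v j ≡ p) (punchIn-punchOut (j≢fv ∘ sym))
    (∣is1∣≡p⇒≡p (otherDegrees v) (sum-otherDegrees v)
      (trans (sym (soleCount≡∣is1∘otherDegrees∣ v)) (soleCount≡p v)) _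
      (d≢1 ∘ subst (λ j → d v j ≡ 1) (punchIn-punchOut (j≢fv ∘ sym))))

  d>0 : ∀ {v j} → j ≢ f v → 1 ≤ d v j
  d>0 {v} {j} j≢fv with d v j ≟ 1
  ... | yes d≡1 = ≤-reflexive (sym d≡1)
  ... | no  d≢1 = subst (1 ≤_) (sym (d≢1⇒≡p j≢fv d≢1)) (≤-trans (s≤s z≤n) p≥2)

  sole⇒centre : ∀ {v w} → adj G v w ≡ true → sole G f v w ≡ true → d w (f v) ≡ p
  sole⇒centre {v} {w} vw sole-vw =
    d≢1⇒≡p (proper v w vw) λ d≡1 →
      contradiction (trans (sym (dec-true (_ ≟ 1) d≡1)) (sole⇒¬sole vw sole-vw)) λ ()

  ¬sole⇒leaf : ∀ {v w} → adj G v w ≡ true → sole G f v w ≡ false → d w (f v) ≡ 1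
  ¬sole⇒leaf {v} {w} vw ¬sole-vw with star⇒sole G f star vw
  ... | inj₁ sole-vw = contradiction (trans (sym sole-vw) ¬sole-vw) λ ()
  ... | inj₂ sole-wv = fromDoes (d w (f v) ≟ 1) sole-wv

  fall : IsFall G f
  fall = proper , λ v i → sees v i
    where
    sees : ∀ v i → (f v ≡ i) ⊎ (∃[ w ] (adj G v w ≡ true × f w ≡ i))
    sees v i with f v Fin.≟ i
    ... | yes fv≡i = inj₁ fv≡i
    ... | no  fv≢i = inj₂ (colourDegree>0⇒nbr G f (d>0 (fv≢i ∘ sym)))

  centre⇒star : ∀ {α β c} → f c ≡ α → d c β ≡ p →
                ∀ {v} → closedColourNbhd G f c β v → ComponentIsoStar G f α β v p
  centre⇒star {α} {β} {c} fc≡α dcβ≡p = centre⇒ComponentIsoStar G f proper fc≡α dcβ≡p leaf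
    where
    leaf : ∀ {x} → adj G c x ≡ true → f x ≡ β → d x α ≡ 1
    leaf {x} cx fx≡β = subst (λ γ → d x γ ≡ 1) fc≡α (¬sole⇒leaf cx
      (dec-false (d c (f x) ≟ 1) (λ d≡1 → p≢1 (trans (sym dcβ≡p) (subst (λ γ → d c γ ≡ 1) fx≡β d≡1)))))

  component-of-colour : ∀ {α β v} → α ≢ β → f v ≡ α → ComponentIsoStar G f α β v p
  component-of-colour {α} {β} {v} α≢β fv≡α with d v β ≟ 1
  ... | no  d≢1 = centre⇒star fv≡α (d≢1⇒≡p (α≢β ∘ trans (sym fv≡α) ∘ sym) d≢1) (inj₁ refl)
  ... | yes d≡1 =
    let u , vu , fu≡β = colourDegree>0⇒nbr G f (≤-reflexive (sym d≡1))
        sole-vu = subst (λ γ → is1 (d v γ) ≡ true) (sym fu≡β) (dec-true (_ ≟ 1) d≡1)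
        duα≡p = subst (λ γ → d u γ ≡ p) fv≡α (sole⇒centre vu sole-vu)
    in ComponentIsoStar-swap G f (centre⇒star fu≡β duα≡p (inj₂ (trans (adj-sym G u v) vu , fv≡α)))

  components : ∀ i j → i ≢ j → ∀ v → InBi f i j v → ComponentIsoStar G f i j v p
  components i j i≢j v (inj₁ fv≡i) = component-of-colour i≢j fv≡i
  components i j i≢j v (inj₂ fv≡j) = ComponentIsoStar-swap G f (component-of-colour (i≢j ∘ sym) fv≡j)

  module ClassSize (i : Fin (2 + p)) where

    inClass isLeaf isCentre : V → Bool
    inClass  w = does (f w Fin.≟ i)
    isLeaf   w = is1 (d w i)
    isCentre w = does (d w i ≟ p)

    vertex-kind : ∀ w → 𝟙 (inClass w) + 𝟙 (isLeaf w) + 𝟙 (isCentre w) ≡ 1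
                      × d w i ≡ 𝟙 (isLeaf w) + p * 𝟙 (isCentre w)
    vertex-kind w with f w Fin.≟ i
    ... | yes fw≡i rewrite subst (λ γ → d w γ ≡ 0) fw≡i (colourDegree-own G f proper w)
                         | 𝟙-no (0 ≟ p) (p≢0 ∘ sym) = refl , sym (*-zeroʳ p)
    ... | no fw≢i with d w i ≟ 1
    ...   | yes d≡1 rewrite d≡1 | 𝟙-no (1 ≟ p) (p≢1 ∘ sym) = refl , cong suc (sym (*-zeroʳ p))
    ...   | no  d≢1 rewrite d≢1⇒≡p (fw≢i ∘ sym) d≢1 | 𝟙-no (p ≟ 1) p≢1 | 𝟙-yes (p ≟ p) refl =
      refl , sym (*-identityʳ p)

    x L B : ℕ
    x = ∣ inClass ∣
    L = ∣ isLeaf ∣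
    B = ∣ isCentre ∣

    n≡x+L+B : n G ≡ x + L + B
    n≡x+L+B = begin
      n G
        ≡⟨ trans (sym (*-identityʳ (n G))) (sym (sum-const (n G) 1)) ⟩
      ∑[ w < n G ] 1
        ≡⟨ sum-cong-≗ (λ w → sym (proj₁ (vertex-kind w))) ⟩
      ∑[ w < n G ] (𝟙 (inClass w) + 𝟙 (isLeaf w) + 𝟙 (isCentre w))
        ≡⟨ ∑-distrib-+ (λ w → 𝟙 (inClass w) + 𝟙 (isLeaf w)) (𝟙 ∘ isCentre) ⟩
      ∑[ w < n G ] (𝟙 (inClass w) + 𝟙 (isLeaf w)) + B
        ≡⟨ cong (_+ B) (∑-distrib-+ (𝟙 ∘ inClass) (𝟙 ∘ isLeaf)) ⟩
      x + L + B ∎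
      where open ≡-Reasoning

    ∑d≡L+p*B : ∑[ w < n G ] d w i ≡ L + p * B
    ∑d≡L+p*B = begin
      ∑[ w < n G ] d w i
        ≡⟨ sum-cong-≗ (λ w → proj₂ (vertex-kind w)) ⟩
      ∑[ w < n G ] (𝟙 (isLeaf w) + p * 𝟙 (isCentre w))
        ≡⟨ ∑-distrib-+ (𝟙 ∘ isLeaf) (λ w → p * 𝟙 (isCentre w)) ⟩
      L + ∑[ w < n G ] (p * 𝟙 (isCentre w))
        ≡⟨ cong (L +_) (*-distribˡ-sum p (𝟙 ∘ isCentre)) ⟨
      L + p * B ∎
      where open ≡-Reasoning

    ∑d≡2p*x : ∑[ w < n G ] d w i ≡ (2 * p) * x
    ∑d≡2p*x = begin
      ∑[ w < n G ] d w i
        ≡⟨ sum-cong-≗ (λ w → trans (colourDegree≡nbrSum G f w i) (sym (*-identityˡ _))) ⟩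
      ∑[ w < n G ] (1 * nbrSum G w (𝟙 ∘ inClass))
        ≡⟨ nbrSum-weighted-flip G (𝟙 ∘ inClass) (λ _ → 1) ⟨
      ∑[ v < n G ] (𝟙 (inClass v) * nbrSum G v (λ _ → 1))
        ≡⟨ sum-𝟙*≡*∣∣ inClass _ (2 * p) (λ v _ → trans (nbrSum-1≡degree G v) (regular v)) ⟩
      (2 * p) * x ∎
      where open ≡-Reasoning

    centre⇔sole : ∀ {v w} → f v ≡ i → adj G v w ≡ true → 𝟙 (isCentre w) ≡ s v w
    centre⇔sole {v} {w} fv≡i vw with sole G f v w in sole-vw
    ... | true  = 𝟙-yes (d w i ≟ p) (subst (λ γ → d w γ ≡ p) fv≡i (sole⇒centre vw sole-vw))
    ... | false = 𝟙-no (d w i ≟ p) λ d≡p →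
      p≢1 (trans (sym d≡p) (subst (λ γ → d w γ ≡ 1) fv≡i (¬sole⇒leaf vw sole-vw)))

    -- Both sides count the edges between V_i and the centres.
    p*x≡p*B : p * x ≡ p * B
    p*x≡p*B = begin
      p * x
        ≡⟨ sum-𝟙*≡*∣∣ inClass _ p soleCentres ⟨
      ∑[ v < n G ] (𝟙 (inClass v) * nbrSum G v (𝟙 ∘ isCentre))
        ≡⟨ nbrSum-weighted-flip G (𝟙 ∘ inClass) (𝟙 ∘ isCentre) ⟩
      ∑[ w < n G ] (𝟙 (isCentre w) * d′ w)
        ≡⟨ sum-𝟙*≡*∣∣ isCentre d′ p centre-degree ⟩
      p * B ∎
      where
      open ≡-Reasoning
      d′ = λ w → nbrSum G w (𝟙 ∘ inClass)
      centre-degree : ∀ w → isCentre w ≡ true → d′ w ≡ p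
      centre-degree w c = trans (sym (colourDegree≡nbrSum G f w i)) (fromDoes (d w i ≟ p) c)
      soleCentres : ∀ v → inClass v ≡ true → nbrSum G v (𝟙 ∘ isCentre) ≡ p
      soleCentres v c = trans (sum-cong-≗ (term (fromDoes (f v Fin.≟ i) c))) (soleCount≡p v)
        where
        term : f v ≡ i → ∀ w → 𝟙 (adj G v w) * 𝟙 (isCentre w) ≡ 𝟙 (adj G v w) * s v w
        term fv≡i w with adj G v w in vw
        ... | false = refl
        ... | true  = cong (1 *_) (centre⇔sole fv≡i vw)

    x≡B : x ≡ B
    x≡B = *-cancelˡ-≡ x B p {{≢-nonZero p≢0}} p*x≡p*B

    L≡p*x : L ≡ p * x
    L≡p*x = +-cancelʳ-≡ (p * x) L (p * x) (begin
      L + p * x          ≡⟨ cong (λ b → L + p * b) x≡B ⟩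
      L + p * B          ≡⟨ ∑d≡L+p*B ⟨
      ∑[ w < n G ] d w i ≡⟨ ∑d≡2p*x ⟩
      (2 * p) * x        ≡⟨ *-assoc 2 p x ⟩
      p * x + (p * x + 0) ≡⟨ cong (p * x +_) (+-identityʳ (p * x)) ⟩
      p * x + p * x      ∎)
      where open ≡-Reasoning

    n≡[2+p]*classSize : n G ≡ (2 + p) * classSize G f i
    n≡[2+p]*classSize = begin
      n G                ≡⟨ n≡x+L+B ⟩
      x + L + B          ≡⟨ cong₂ (λ l b → x + l + b) L≡p*x (sym x≡B) ⟩
      x + p * x + x      ≡⟨ +-assoc x (p * x) x ⟩
      x + (p * x + x)    ≡⟨ cong (x +_) (+-comm (p * x) x) ⟩
      (2 + p) * x        ≡⟨ cong ((2 + p) *_) (count≡∣∣ inClass) ⟨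
      (2 + p) * classSize G f i ∎
      where open ≡-Reasoning

  classSizes-equal : ∀ i j → classSize G f i ≡ classSize G f j
  classSizes-equal i j = *-cancelˡ-≡ _ _ (2 + p)
    (trans (sym (ClassSize.n≡[2+p]*classSize i)) (ClassSize.n≡[2+p]*classSize j))

  equitable : IsEquitable G f
  equitable i j = ≤-trans (≤-reflexive (classSizes-equal i j)) (m≤m+n _ 1)

theorem2 : (p : ℕ) → 2 ≤ p → (G : Graph) → Regular (2 * p) G →
    (f : Colouring G (p + 2)) → IsStarColouring G f →
    ((i j : Fin (p + 2)) → i ≢ j → (v : Fin (n G)) → InBi f i j v →
       ComponentIsoStar G f i j v p)
    × ((i j : Fin (p + 2)) → classSize G f i ≡ classSize G f j)
    × IsEquitable G f
    × IsFall G f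
theorem2 p p≥2 G regular f star with p + 2 | +-comm p 2
... | _ | refl = components , classSizes-equal , equitable , fall
  where open RegularStarColouring p≥2 regular star
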